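{- Let $\Gamma$ and $\Sigma$ be two connected graphs without isolated vertices. Then $\Gamma\Box\Sigma$ is $R$-thick if and only if both $\Gamma$ and $\Sigma$ are isomorphic to $K_2$.
   Context: All graphs are finite, undirected and simple. $K_2$ is the complete graph on two vertices. The Cartesian product $\Gamma\Box\Sigma$ has vertex set $V(\Gamma)\times V(\Sigma)$, with $(a,x)\sim(b,y)$ iff ($a=b$ and $x\sim_\Sigma y$) or ($a\sim_\Gamma b$ and $x=y$). A graph is $R$-thick if two distinct vertices have the same neighbourhood. -}

module Defs where

open import Level using (0ℓ)
open import Data.Nat using (ℕ)
open import Data.Fin using (Fin; zero; suc)
open import Data.Product using (Σ; ∃; _×_; _,_)
open import Data.Sum using (_⊎_)
open import Data.Empty using (⊥)
open import Relation.Nullary using (¬_; Dec)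
open import Relation.Binary.PropositionalEquality using (_≡_)
open import Function.Bundles using (_↔_)
open import Function using (_⇔_)
open import Function.Bundles using (Inverse; mk↔ₛ′)
open import Relation.Nullary using (yes; no)
open import Relation.Binary.PropositionalEquality using (refl; cong; cong₂; sym; trans)
open import Data.Empty using (⊥-elim)
open import Data.Sum using (inj₁; inj₂)
open import Data.Nat using (_*_)
open import Data.Fin.Properties using (_≟_)
open import Data.Fin.Properties using (*↔×)
open import Function.Properties.Inverse using (↔-sym; ↔-trans)
open import Data.Product.Function.NonDependent.Propositional using (_×-↔_)

record Graph : Set₁ where
  field
    V       : Set
    size    : ℕ
    finite  : V ↔ Fin size
    _∼_     : V → V → Set
    ∼-dec   : ∀ x y → Dec (x ∼ y)
    ∼-prop  : ∀ {x y} (p q : x ∼ y) → p ≡ q   -- no multiple edges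
    ∼-sym   : ∀ {x y} → x ∼ y → y ∼ x
    ∼-irr   : ∀ {x} → ¬ (x ∼ x)

open Graph public

data Walk (G : Graph) : V G → V G → Set where
  here  : ∀ {x} → Walk G x x
  step  : ∀ {x y z} → _∼_ G x y → Walk G y z → Walk G x z

Connected : Graph → Set
Connected G = ∀ (x y : V G) → Walk G x y

IsolatedVertex : (G : Graph) → V G → Set
IsolatedVertex G x = ∀ y → ¬ (_∼_ G x y)

NoIsolatedVertices : Graph → Set
NoIsolatedVertices G = ∀ x → ¬ IsolatedVertex G x

record _≅_ (G H : Graph) : Set where
  field
    bij  : V G ↔ V H
    pres : ∀ x y → (_∼_ G x y ⇔ _∼_ H (Inverse.to bij x) (Inverse.to bij y))

data K2-adj : Fin 2 → Fin 2 → Set where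
  e01 : K2-adj zero (suc zero)
  e10 : K2-adj (suc zero) zero

K2 : Graph
K2 = record
  { V = Fin 2 ; size = 2 ; finite = mk↔ₛ′ (λ x → x) (λ x → x) (λ _ → refl) (λ _ → refl)
  ; _∼_ = K2-adj ; ∼-dec = dec ; ∼-prop = prop ; ∼-sym = sym' ; ∼-irr = irr }
  where
  dec : ∀ x y → Dec (K2-adj x y)
  dec zero zero = no λ ()
  dec zero (suc zero) = yes e01
  dec (suc zero) zero = yes e10
  dec (suc zero) (suc zero) = no λ ()
  prop : ∀ {x y} (p q : K2-adj x y) → p ≡ q
  prop e01 e01 = refl
  prop e10 e10 = refl
  sym' : ∀ {x y} → K2-adj x y → K2-adj y x
  sym' e01 = e10
  sym' e10 = e01
  irr : ∀ {x} → ¬ K2-adj x x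
  irr ()

data □-adj (G H : Graph) : V G × V H → V G × V H → Set where
  right : ∀ {a x y} → _∼_ H x y → □-adj G H (a , x) (a , y)
  left  : ∀ {a b x} → _∼_ G a b → □-adj G H (a , x) (b , x)

V-≟ : (G : Graph) → (x y : V G) → Dec (x ≡ y)
V-≟ G x y with Inverse.to (finite G) x ≟ Inverse.to (finite G) y
... | yes p = yes (trans (sym (Inverse.strictlyInverseʳ (finite G) x))
                   (trans (cong (Inverse.from (finite G)) p) (Inverse.strictlyInverseʳ (finite G) y)))
... | no ¬p = no (λ e → ¬p (cong (Inverse.to (finite G)) e))

□-dec : (G H : Graph) → ∀ u w → Dec (□-adj G H u w)
□-dec G H (a , x) (b , y) with V-≟ G a b | V-≟ H x y
... | yes refl | yes refl = no λ { (right p) → ∼-irr H p ; (left q) → ∼-irr G q }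
... | yes refl | no x≢y with ∼-dec H x y
...   | yes p = yes (right p)
...   | no ¬p = no λ { (right p) → ¬p p ; (left q) → x≢y refl }
□-dec G H (a , x) (b , y) | no a≢b | yes refl with ∼-dec G a b
...   | yes q = yes (left q)
...   | no ¬q = no λ { (right p) → a≢b refl ; (left q) → ¬q q }
□-dec G H (a , x) (b , y) | no a≢b | no x≢y = no λ { (right p) → a≢b refl ; (left q) → x≢y refl }

□-prop : (G H : Graph) → ∀ {u w} (p q : □-adj G H u w) → p ≡ q
□-prop G H (right p) (right q) = cong right (∼-prop H p q)
□-prop G H (right p) (left q) = ⊥-elim (∼-irr G q)
□-prop G H (left p) (right q) = ⊥-elim (∼-irr G p)
□-prop G H (left p) (left q) = cong left (∼-prop G p q)

□-sym : (G H : Graph) → ∀ {u w} → □-adj G H u w → □-adj G H w u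
□-sym G H (right p) = right (∼-sym H p)
□-sym G H (left q) = left (∼-sym G q)

□-irr : (G H : Graph) → ∀ {u} → ¬ □-adj G H u u
□-irr G H (right p) = ∼-irr H p
□-irr G H (left q) = ∼-irr G q

_□_ : Graph → Graph → Graph
G □ H = record
  { V = V G × V H
  ; size = size G * size H
  ; finite = ↔-trans (finite G ×-↔ finite H) (↔-sym *↔×)
  ; _∼_ = □-adj G H ; ∼-dec = □-dec G H ; ∼-prop = □-prop G H
  ; ∼-sym = □-sym G H ; ∼-irr = □-irr G H }

RThick : Graph → Set
RThick G = Σ (V G) λ u → Σ (V G) λ w → ¬ (u ≡ w) × (∀ z → (_∼_ G u z ⇔ _∼_ G w z))

-- If (a , x) and (b , y) have the same neighbourhood in Γ □ Σ, then a ≢ b: otherwise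
-- x ≢ y, and a neighbour (a′ , x) of (a , x) could not be adjacent to (a , y).  Likewise
-- x ≢ y.  Hence a neighbour c of a gives (c , x) ∼ (b , y) across distinct second
-- coordinates, forcing c ≡ b; so ab is an edge whose endpoints have no other
-- neighbours, and by connectedness it is all of Γ.  Conversely K₂ □ K₂ is the 4-cycle,
-- whose opposite corners share their neighbourhood.
module Submission where

open import Defs
open import Data.Fin using (Fin; zero; suc)
open import Data.Product using (_×_; _,_; ∃₂; proj₁; swap)
open import Data.Sum using (_⊎_; inj₁; inj₂)
open import Data.Empty using (⊥-elim)
open import Function using (_⇔_; _∘_; const)
open import Function.Bundles using (Equivalence; Inverse; mk⇔; mk↔ₛ′)
open import Function.Properties.Equivalence using () renaming (sym to ⇔-sym)
open import Relation.Nullary using (¬_)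
open import Relation.Binary.PropositionalEquality using (_≡_; refl; sym; trans; cong; subst; subst₂)

SameNeighbourhood : (G : Graph) → V G → V G → Set
SameNeighbourhood G u w = ∀ z → _∼_ G u z ⇔ _∼_ G w z

record IsolatedEdge (G : Graph) (p q : V G) : Set where
  field
    edge   : _∼_ G p q
    only-q : ∀ {z} → _∼_ G p z → z ≡ q
    only-p : ∀ {z} → _∼_ G q z → z ≡ p

open IsolatedEdge

HasIsolatedEdge : Graph → Set
HasIsolatedEdge G = ∃₂ (IsolatedEdge G)

isolatedEdge-sym : ∀ {G p q} → IsolatedEdge G p q → IsolatedEdge G q p
isolatedEdge-sym {G} e = record { edge = ∼-sym G (edge e) ; only-q = only-p e ; only-p = only-q e }

isolatedEdge-distinct : ∀ {G p q} → IsolatedEdge G p q → ¬ p ≡ q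
isolatedEdge-distinct {G} e refl = ∼-irr G (edge e)

isolatedEdge-covers : ∀ {G p q} → Connected G → IsolatedEdge G p q → ∀ z → z ≡ p ⊎ z ≡ q
isolatedEdge-covers {G} {p} {q} conn e z = walk-stays (conn p z) (inj₁ refl)
  where
  walk-stays : ∀ {s t} → Walk G s t → s ≡ p ⊎ s ≡ q → t ≡ p ⊎ t ≡ q
  walk-stays here               s∈pq        = s∈pq
  walk-stays (step s∼s′ s′⇝t) (inj₁ refl) = walk-stays s′⇝t (inj₂ (only-q e s∼s′))
  walk-stays (step s∼s′ s′⇝t) (inj₂ refl) = walk-stays s′⇝t (inj₁ (only-p e s∼s′))

connected-onlyNeighbour⇒adjacent : ∀ {G p q} → Connected G → ¬ p ≡ q →
                                   (∀ {z} → _∼_ G p z → z ≡ q) → _∼_ G p q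
connected-onlyNeighbour⇒adjacent {G} {p} {q} conn p≢q only = first-edge (conn p q)
  where
  first-edge : Walk G p q → _∼_ G p q
  first-edge here         = ⊥-elim (p≢q refl)
  first-edge (step p∼z _) = subst (_∼_ G p) (only p∼z) p∼z

two-vertices⇒≅K2 : ∀ {G p q} → _∼_ G p q → (∀ z → z ≡ p ⊎ z ≡ q) → G ≅ K2
two-vertices⇒≅K2 {G} {p} {q} p∼q p-or-q =
  record { bij = mk↔ₛ′ index vertex index-vertex vertex-index ; pres = pres }
  where
  p≢q : ¬ p ≡ q
  p≢q refl = ∼-irr G p∼q

  vertex : Fin 2 → V G
  vertex zero       = p
  vertex (suc zero) = q

  index : V G → Fin 2
  index z with p-or-q z
  ... | inj₁ _ = zero
  ... | inj₂ _ = suc zero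

  index-vertex : ∀ i → index (vertex i) ≡ i
  index-vertex zero with p-or-q p
  ... | inj₁ _   = refl
  ... | inj₂ p≡q = ⊥-elim (p≢q p≡q)
  index-vertex (suc zero) with p-or-q q
  ... | inj₁ q≡p = ⊥-elim (p≢q (sym q≡p))
  ... | inj₂ _   = refl

  vertex-index : ∀ z → vertex (index z) ≡ z
  vertex-index z with p-or-q z
  ... | inj₁ z≡p = sym z≡p
  ... | inj₂ z≡q = sym z≡q

  vertex-adj : ∀ i j → _∼_ G (vertex i) (vertex j) ⇔ K2-adj i j
  vertex-adj zero       zero       = mk⇔ (⊥-elim ∘ ∼-irr G) λ ()
  vertex-adj zero       (suc zero) = mk⇔ (const e01) (const p∼q)
  vertex-adj (suc zero) zero       = mk⇔ (const e10) (const (∼-sym G p∼q))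
  vertex-adj (suc zero) (suc zero) = mk⇔ (⊥-elim ∘ ∼-irr G) λ ()

  pres : ∀ x y → _∼_ G x y ⇔ K2-adj (index x) (index y)
  pres x y = subst₂ (λ x′ y′ → _∼_ G x′ y′ ⇔ K2-adj (index x) (index y))
                    (vertex-index x) (vertex-index y) (vertex-adj (index x) (index y))

connected-hasIsolatedEdge⇒≅K2 : ∀ {G} → Connected G → HasIsolatedEdge G → G ≅ K2
connected-hasIsolatedEdge⇒≅K2 conn (_ , _ , e) = two-vertices⇒≅K2 (edge e) (isolatedEdge-covers conn e)

≅-reflects-isolatedEdge : ∀ {G H u v} (f : G ≅ H) → IsolatedEdge H u v →
                          IsolatedEdge G (Inverse.from (_≅_.bij f) u) (Inverse.from (_≅_.bij f) v)
≅-reflects-isolatedEdge {G} {H} {u} {v} f e =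
  record { edge = edge′ ; only-q = only (only-q e) ; only-p = only (only-p e) }
  where
  open _≅_ f
  open Inverse bij using (to; from; strictlyInverseˡ; strictlyInverseʳ)

  edge′ : _∼_ G (from u) (from v)
  edge′ = Equivalence.from (pres (from u) (from v))
            (subst₂ (_∼_ H) (sym (strictlyInverseˡ u)) (sym (strictlyInverseˡ v)) (edge e))

  only : ∀ {s t} → (∀ {w} → _∼_ H s w → w ≡ t) → ∀ {z} → _∼_ G (from s) z → z ≡ from t
  only {s} only-t {z} fs∼z =
    trans (sym (strictlyInverseʳ z))
          (cong from (only-t (subst (λ s′ → _∼_ H s′ (to z)) (strictlyInverseˡ s)
                                    (Equivalence.to (pres (from s) z) fs∼z))))

K2-isolatedEdge : IsolatedEdge K2 zero (suc zero)
K2-isolatedEdge = record { edge = e01 ; only-q = λ { e01 → refl } ; only-p = λ { e10 → refl } }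

≅K2⇒hasIsolatedEdge : ∀ {G} → G ≅ K2 → HasIsolatedEdge G
≅K2⇒hasIsolatedEdge f = _ , _ , ≅-reflects-isolatedEdge f K2-isolatedEdge

□-adj-swap : ∀ {G H a b x y} → □-adj G H (a , x) (b , y) → □-adj H G (x , a) (y , b)
□-adj-swap (right x∼y) = left x∼y
□-adj-swap (left a∼b)  = right a∼b

sameNbhd-□-swap : ∀ {G H a b x y} → SameNeighbourhood (G □ H) (a , x) (b , y) →
                  SameNeighbourhood (H □ G) (x , a) (y , b)
sameNbhd-□-swap same (z , c) = mk⇔ (□-adj-swap ∘ Equivalence.to   (same (c , z)) ∘ □-adj-swap)
                                   (□-adj-swap ∘ Equivalence.from (same (c , z)) ∘ □-adj-swap)

RThick-□-swap : ∀ {G H} → RThick (G □ H) → RThick (H □ G)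
RThick-□-swap ((a , x) , (b , y) , u≢w , same) =
  (x , a) , (y , b) , u≢w ∘ cong swap , sameNbhd-□-swap same

□-adj-across⇒fst≡ : ∀ {G H b c x y} → ¬ x ≡ y → □-adj G H (b , y) (c , x) → c ≡ b
□-adj-across⇒fst≡ x≢y (right _) = refl
□-adj-across⇒fst≡ x≢y (left _)  = ⊥-elim (x≢y refl)

sameNbhd-□-neighbour : ∀ {G H a b c x y} → SameNeighbourhood (G □ H) (a , x) (b , y) →
                       ¬ x ≡ y → _∼_ G a c → c ≡ b
sameNbhd-□-neighbour {c = c} {x} same x≢y a∼c =
  □-adj-across⇒fst≡ x≢y (Equivalence.to (same (c , x)) (left a∼c))

sameNbhd-□-fst≢ : ∀ {G H a b x y} → NoIsolatedVertices G → ¬ (a , x) ≡ (b , y) →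
                  SameNeighbourhood (G □ H) (a , x) (b , y) → ¬ a ≡ b
sameNbhd-□-fst≢ {G} {a = a} {x = x} {y} noIsolated u≢w same refl =
  noIsolated a λ c a∼c → ∼-irr G (subst (_∼_ G a) (sameNbhd-□-neighbour same x≢y a∼c) a∼c)
  where
  x≢y : ¬ x ≡ y
  x≢y refl = u≢w refl

RThick-□⇒hasIsolatedEdge : ∀ {G H} → Connected G → NoIsolatedVertices G → NoIsolatedVertices H →
                           RThick (G □ H) → HasIsolatedEdge G
RThick-□⇒hasIsolatedEdge {G} conn noIsolatedG noIsolatedH ((a , x) , (b , y) , u≢w , same) =
  a , b , record { edge   = connected-onlyNeighbour⇒adjacent conn a≢b only-b
                 ; only-q = only-b
                 ; only-p = only-a }
  where
  a≢b : ¬ a ≡ b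
  a≢b = sameNbhd-□-fst≢ noIsolatedG u≢w same

  x≢y : ¬ x ≡ y
  x≢y = sameNbhd-□-fst≢ noIsolatedH (u≢w ∘ cong swap) (sameNbhd-□-swap same)

  only-b : ∀ {c} → _∼_ G a c → c ≡ b
  only-b = sameNbhd-□-neighbour same x≢y

  only-a : ∀ {c} → _∼_ G b c → c ≡ a
  only-a = sameNbhd-□-neighbour (⇔-sym ∘ same) (x≢y ∘ sym)

□-isolatedEdges-opposite : ∀ {G H a b x y} → IsolatedEdge G a b → IsolatedEdge H x y →
                           ∀ {z} → □-adj G H (a , x) z → □-adj G H (b , y) z
□-isolatedEdges-opposite {G} {H} eG eH (right x∼y′) with only-q eH x∼y′
... | refl = left (∼-sym G (edge eG))
□-isolatedEdges-opposite {G} {H} eG eH (left a∼c) with only-q eG a∼c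
... | refl = right (∼-sym H (edge eH))

hasIsolatedEdges⇒RThick-□ : ∀ {G H} → HasIsolatedEdge G → HasIsolatedEdge H → RThick (G □ H)
hasIsolatedEdges⇒RThick-□ (a , b , eG) (x , y , eH) =
  (a , x) , (b , y) , isolatedEdge-distinct eG ∘ cong proj₁ ,
  λ _ → mk⇔ (□-isolatedEdges-opposite eG eH)
            (□-isolatedEdges-opposite (isolatedEdge-sym eG) (isolatedEdge-sym eH))

corollary3p3 : (Γ Σ' : Graph) → Connected Γ → Connected Σ' →
    NoIsolatedVertices Γ → NoIsolatedVertices Σ' →
    (RThick (Γ □ Σ') ⇔ ((Γ ≅ K2) × (Σ' ≅ K2)))
corollary3p3 Γ Σ' connΓ connΣ noIsolatedΓ noIsolatedΣ = mk⇔ thick⇒K2 K2⇒thick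
  where
  thick⇒K2 : RThick (Γ □ Σ') → (Γ ≅ K2) × (Σ' ≅ K2)
  thick⇒K2 thick =
      connected-hasIsolatedEdge⇒≅K2 connΓ (RThick-□⇒hasIsolatedEdge connΓ noIsolatedΓ noIsolatedΣ thick)
    , connected-hasIsolatedEdge⇒≅K2 connΣ
        (RThick-□⇒hasIsolatedEdge connΣ noIsolatedΣ noIsolatedΓ (RThick-□-swap thick))

  K2⇒thick : (Γ ≅ K2) × (Σ' ≅ K2) → RThick (Γ □ Σ')
  K2⇒thick (f , g) = hasIsolatedEdges⇒RThick-□ (≅K2⇒hasIsolatedEdge f) (≅K2⇒hasIsolatedEdge g)
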